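{- Let $\psi(x)$ be a formula with a single free variable and no parameters and let $r\subseteq\omega$. Any formula occurring in a sequent $l(\sigma)$ with $\sigma\in S^r_\psi(\mathbb V)$ is a substitution instance of a subformula of $\neg\psi(r)$ or of $\neg\forall_{x,y}(\forall_z(z\in x\leftrightarrow z\in y)\to x=y)$.
   Context: Formulas are in negation normal form (negation computed by de Morgan's rules) and may contain sets as parameters; a substitution instance replaces free variables by parameters. For a set $M\supseteq\omega\cup\{r\}$, the tree $S^r_\psi(M)\subseteq M^{<\omega}$ with labelling $l_M$ (into finite sequences of closed formulas with parameters from $M$) is defined by recursion: $\langle\rangle\in S^r_\psi(M)$, $l_M(\langle\rangle)=\langle\neg\psi(r),\neg\forall_{x,y}(\forall_z(z\in x\leftrightarrow z\in y)\to x=y)\rangle$; $\sigma^\frown a$ can be in the tree only if $\sigma$ is. For $\sigma\in S^r_\psi(M)$ with $l_M(\sigma)=\varphi,\Gamma$: if $\varphi$ is a true literal, $\sigma$ is a leaf; if $\varphi$ is a false literal, $\sigma^\frown a\in S^r_\psi(M)$ iff $a=0$, $l_M(\sigma^\frown0)=\Gamma,\varphi$; if $\varphi\equiv\varphi_0\land\varphi_1$, $\sigma^\frown a\in S^r_\psi(M)$ iff $a\in\{0,1\}$, $l_M(\sigma^\frown a)=\Gamma,\varphi,\varphi_a$; if $\varphi\equiv\varphi_0\lor\varphi_1$, $\sigma^\frown a\in S^r_\psi(M)$ iff $a=0$, $l_M(\sigma^\frown0)=\Gamma,\varphi,\varphi_0,\varphi_1$; if $\varphi\equiv\forall_x\theta(x)$,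 $\sigma^\frown a\in S^r_\psi(M)$ iff $a\in M$, $l_M(\sigma^\frown a)=\Gamma,\varphi,\theta(a)$; if $\varphi\equiv\exists_x\theta(x)$ and $\sigma=\langle\sigma_0,\dots,\sigma_{n-1}\rangle$, let $b$ be the first entry of $r,\sigma_0,0,\sigma_1,1,\dots,\sigma_{n-1},n-1,n,n+1,\dots$ such that $\theta(b)$ does not occur in $\Gamma$; then $\sigma^\frown a\in S^r_\psi(M)$ iff $a=0$, $l_M(\sigma^\frown0)=\Gamma,\varphi,\theta(b)$. For a finite sequence of sets $\sigma=\langle\sigma_0,\dots,\sigma_{n-1}\rangle$ put $M_\sigma:=\{\sigma_0,\dots,\sigma_{n-1}\}\cup\omega\cup\{r\}$; the class $S^r_\psi(\mathbb V)$ consists of all $\sigma\in\mathbb V^{<\omega}$ with $\sigma\in S^r_\psi(M_\sigma)$, and $l(\sigma):=l_{M_\sigma}(\sigma)$. -}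

module Defs where

open import Data.Nat using (ℕ; zero; suc; _+_; _<_)
open import Data.Fin using (Fin; zero; suc)
open import Data.Bool using (Bool; true; false)
open import Data.List using (List; []; _∷_; _++_; _∷ʳ_)
open import Data.List.Membership.Propositional using (_∈_; _∉_)
open import Data.Product using (Σ; ∃; _×_; _,_)
open import Data.Sum using (_⊎_)
open import Data.Empty using (⊥)
open import Data.Unit using (⊤)
open import Relation.Nullary using (¬_)
open import Relation.Binary.PropositionalEquality using (_≡_)

-- The universe of sets is modelled abstractly: a type V of sets, a membership
-- relation _∈V_ on it, and num : ℕ → V giving the natural numbers (elements of ω).
module SetTheory (V : Set) (_∈V_ : V → V → Set) (num : ℕ → V) where

  data Term (n : ℕ) : Set where
    var : Fin n → Term n
    par : V → Term n

  data Atom (n : ℕ) : Set where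
    mem : Term n → Term n → Atom n
    eqt : Term n → Term n → Atom n

  -- Formulas in negation normal form with at most n free (de Bruijn) variables.
  -- lit true A is the atom A, lit false A is its negation.
  data Formula (n : ℕ) : Set where
    lit  : Bool → Atom n → Formula n
    _∧'_ : Formula n → Formula n → Formula n
    _∨'_ : Formula n → Formula n → Formula n
    all  : Formula (suc n) → Formula n
    ex   : Formula (suc n) → Formula n

  infixr 6 _∧'_
  infixr 5 _∨'_

  negF : ∀ {n} → Formula n → Formula n
  negF (lit true A)  = lit false A
  negF (lit false A) = lit true A
  negF (φ ∧' ψ) = negF φ ∨' negF ψ
  negF (φ ∨' ψ) = negF φ ∧' negF ψ
  negF (all θ) = ex (negF θ)
  negF (ex θ) = all (negF θ)

  _⇒'_ : ∀ {n} → Formula n → Formula n → Formula n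
  φ ⇒' ψ = negF φ ∨' ψ

  _⇔'_ : ∀ {n} → Formula n → Formula n → Formula n
  φ ⇔' ψ = (φ ⇒' ψ) ∧' (ψ ⇒' φ)

  wkT : ∀ {n} → Term n → Term (suc n)
  wkT (var i) = var (suc i)
  wkT (par a) = par a

  liftS : ∀ {m n} → (Fin m → Term n) → Fin (suc m) → Term (suc n)
  liftS ρ zero    = var zero
  liftS ρ (suc i) = wkT (ρ i)

  subT : ∀ {m n} → (Fin m → Term n) → Term m → Term n
  subT ρ (var i) = ρ i
  subT ρ (par a) = par a

  subA : ∀ {m n} → (Fin m → Term n) → Atom m → Atom n
  subA ρ (mem t u) = mem (subT ρ t) (subT ρ u)
  subA ρ (eqt t u) = eqt (subT ρ t) (subT ρ u)

  sub : ∀ {m n} → (Fin m → Term n) → Formula m → Formula n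
  sub ρ (lit b A) = lit b (subA ρ A)
  sub ρ (φ ∧' ψ) = sub ρ φ ∧' sub ρ ψ
  sub ρ (φ ∨' ψ) = sub ρ φ ∨' sub ρ ψ
  sub ρ (all θ) = all (sub (liftS ρ) θ)
  sub ρ (ex θ) = ex (sub (liftS ρ) θ)

  single : ∀ {n} → V → Fin (suc n) → Term n
  single a zero    = par a
  single a (suc i) = var i

  _[_] : ∀ {n} → Formula (suc n) → V → Formula n
  θ [ a ] = sub (single a) θ

  inst : ∀ {n} → (Fin n → V) → Formula n → Formula 0
  inst ρ φ = sub (λ i → par (ρ i)) φ

  data _≼_ {m : ℕ} (φ : Formula m) : ∀ {n} → Formula n → Set where
    here : φ ≼ φ
    ∧ˡ : ∀ {n} {ψ₀ ψ₁ : Formula n} → φ ≼ ψ₀ → φ ≼ (ψ₀ ∧' ψ₁)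
    ∧ʳ : ∀ {n} {ψ₀ ψ₁ : Formula n} → φ ≼ ψ₁ → φ ≼ (ψ₀ ∧' ψ₁)
    ∨ˡ : ∀ {n} {ψ₀ ψ₁ : Formula n} → φ ≼ ψ₀ → φ ≼ (ψ₀ ∨' ψ₁)
    ∨ʳ : ∀ {n} {ψ₀ ψ₁ : Formula n} → φ ≼ ψ₁ → φ ≼ (ψ₀ ∨' ψ₁)
    ∀ᵇ : ∀ {n} {θ : Formula (suc n)} → φ ≼ θ → φ ≼ all θ
    ∃ᵇ : ∀ {n} {θ : Formula (suc n)} → φ ≼ θ → φ ≼ ex θ

  NoParT : ∀ {n} → Term n → Set
  NoParT (var _) = ⊤
  NoParT (par _) = ⊥

  NoParA : ∀ {n} → Atom n → Set
  NoParA (mem t u) = NoParT t × NoParT u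
  NoParA (eqt t u) = NoParT t × NoParT u

  NoParams : ∀ {n} → Formula n → Set
  NoParams (lit _ A) = NoParA A
  NoParams (φ ∧' ψ) = NoParams φ × NoParams ψ
  NoParams (φ ∨' ψ) = NoParams φ × NoParams ψ
  NoParams (all θ) = NoParams θ
  NoParams (ex θ) = NoParams θ

  valT : Term 0 → V
  valT (var ())
  valT (par a) = a

  TrueAtom : Atom 0 → Set
  TrueAtom (mem t u) = valT t ∈V valT u
  TrueAtom (eqt t u) = valT t ≡ valT u

  TrueLit : Bool → Atom 0 → Set
  TrueLit true A  = TrueAtom A
  TrueLit false A = ¬ TrueAtom A

  -- Extensionality: ∀x ∀y (∀z (z ∈ x ↔ z ∈ y) → x = y)
  Ext : Formula 0
  Ext = all (all (all (lit true (mem (var zero) (var (suc (suc zero))))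
                         ⇔' lit true (mem (var zero) (var (suc zero))))
                   ⇒' lit true (eqt (var (suc zero)) (var zero))))

  module Tree (r : V) (ψ : Formula 1) where

    -- The list r, σ₀, 0, σ₁, 1, …, σ_{n-1}, n-1, n, n+1, …
    aux : List V → ℕ → ℕ → V
    aux [] i k = num (i + k)
    aux (x ∷ xs) i zero = x
    aux (x ∷ xs) i (suc zero) = num i
    aux (x ∷ xs) i (suc (suc k)) = aux xs (suc i) k

    cand : List V → ℕ → V
    cand σ zero    = r
    cand σ (suc k) = aux σ 0 k

    -- Node M σ Λ : σ ∈ S^r_ψ(M) with l_M(σ) = Λ.
    data Node (M : V → Set) : List V → List (Formula 0) → Set where
      root : Node M [] (negF (ψ [ r ]) ∷ negF Ext ∷ [])
      falseLit : ∀ {σ Γ b A} → Node M σ (lit b A ∷ Γ) → ¬ TrueLit b A →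
                 Node M (σ ∷ʳ num 0) (Γ ∷ʳ lit b A)
      and0 : ∀ {σ Γ φ₀ φ₁} → Node M σ ((φ₀ ∧' φ₁) ∷ Γ) →
             Node M (σ ∷ʳ num 0) (Γ ++ (φ₀ ∧' φ₁) ∷ φ₀ ∷ [])
      and1 : ∀ {σ Γ φ₀ φ₁} → Node M σ ((φ₀ ∧' φ₁) ∷ Γ) →
             Node M (σ ∷ʳ num 1) (Γ ++ (φ₀ ∧' φ₁) ∷ φ₁ ∷ [])
      or0 : ∀ {σ Γ φ₀ φ₁} → Node M σ ((φ₀ ∨' φ₁) ∷ Γ) →
            Node M (σ ∷ʳ num 0) (Γ ++ (φ₀ ∨' φ₁) ∷ φ₀ ∷ φ₁ ∷ [])
      allR : ∀ {σ Γ θ} (a : V) → M a → Node M σ (all θ ∷ Γ) →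
             Node M (σ ∷ʳ a) (Γ ++ all θ ∷ θ [ a ] ∷ [])
      exR : ∀ {σ Γ θ} (k : ℕ) → Node M σ (ex θ ∷ Γ) →
            (θ [ cand σ k ]) ∉ Γ →
            (∀ j → j < k → (θ [ cand σ j ]) ∈ Γ) →
            Node M (σ ∷ʳ num 0) (Γ ++ ex θ ∷ θ [ cand σ k ] ∷ [])

    Mσ : List V → V → Set
    Mσ σ a = (a ∈ σ) ⊎ (∃ λ n → a ≡ num n) ⊎ (a ≡ r)

    InSV : List V → List (Formula 0) → Set
    InSV σ Λ = Node (Mσ σ) σ Λ

module Submission where

-- Proof idea: call a closed formula an *instance* if it has the form
-- inst ρ φ with φ a subformula of a root.  Instances are closed under every
-- way the tree rules produce new formulas from the principal formula:
-- taking a conjunct or disjunct of an instance, and instantiating the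
-- bound variable of an instance of ∀θ or ∃θ by an arbitrary set a, since
-- plugging a into the body of inst ρ (∀θ) yields inst (a ∷ ρ) θ.  The roots
-- are instances of themselves, so induction over the rules shows that every
-- sequent consists of instances, for an arbitrary domain M.

open import Defs
open import Data.Nat using (ℕ; zero; suc)
open import Data.Fin using (Fin; zero; suc)
open import Data.List using (List)
open import Data.List.Membership.Propositional using (_∈_)
open import Data.List.Relation.Unary.All using (All; []; _∷_; lookup)
open import Data.List.Relation.Unary.All.Properties using (++⁺; ∷ʳ⁺)
open import Data.Vec.Functional using () renaming (_∷_ to _∷ᵥ_)
open import Data.Product using (Σ; ∃; _×_; _,_)
open import Data.Sum using (_⊎_; inj₁; inj₂)
open import Function.Definitions using (Injective)
open import Relation.Binary.PropositionalEquality
  using (_≡_; refl; cong; cong₂; trans; module ≡-Reasoning)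

module SubformulaProperty (V : Set) (_∈V_ : V → V → Set) (num : ℕ → V) where
  open SetTheory V _∈V_ num

  subT-cong : ∀ {m n} {ρ ρ' : Fin m → Term n} → (∀ i → ρ i ≡ ρ' i) →
              ∀ t → subT ρ t ≡ subT ρ' t
  subT-cong e (var i) = e i
  subT-cong e (par a) = refl

  subA-cong : ∀ {m n} {ρ ρ' : Fin m → Term n} → (∀ i → ρ i ≡ ρ' i) →
              ∀ A → subA ρ A ≡ subA ρ' A
  subA-cong e (mem t u) = cong₂ mem (subT-cong e t) (subT-cong e u)
  subA-cong e (eqt t u) = cong₂ eqt (subT-cong e t) (subT-cong e u)

  liftS-cong : ∀ {m n} {ρ ρ' : Fin m → Term n} → (∀ i → ρ i ≡ ρ' i) →
               ∀ i → liftS ρ i ≡ liftS ρ' i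
  liftS-cong e zero    = refl
  liftS-cong e (suc i) = cong wkT (e i)

  sub-cong : ∀ {m n} {ρ ρ' : Fin m → Term n} → (∀ i → ρ i ≡ ρ' i) →
             ∀ φ → sub ρ φ ≡ sub ρ' φ
  sub-cong e (lit b A) = cong (lit b) (subA-cong e A)
  sub-cong e (φ ∧' ψ)  = cong₂ _∧'_ (sub-cong e φ) (sub-cong e ψ)
  sub-cong e (φ ∨' ψ)  = cong₂ _∨'_ (sub-cong e φ) (sub-cong e ψ)
  sub-cong e (all θ)   = cong all (sub-cong (liftS-cong e) θ)
  sub-cong e (ex θ)    = cong ex (sub-cong (liftS-cong e) θ)

  _⊙_ : ∀ {k m n} → (Fin m → Term n) → (Fin k → Term m) → Fin k → Term n
  (σ ⊙ τ) i = subT σ (τ i)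

  subT-⊙ : ∀ {k m n} (σ : Fin m → Term n) (τ : Fin k → Term m) t →
           subT σ (subT τ t) ≡ subT (σ ⊙ τ) t
  subT-⊙ σ τ (var i) = refl
  subT-⊙ σ τ (par a) = refl

  subA-⊙ : ∀ {k m n} (σ : Fin m → Term n) (τ : Fin k → Term m) A →
           subA σ (subA τ A) ≡ subA (σ ⊙ τ) A
  subA-⊙ σ τ (mem t u) = cong₂ mem (subT-⊙ σ τ t) (subT-⊙ σ τ u)
  subA-⊙ σ τ (eqt t u) = cong₂ eqt (subT-⊙ σ τ t) (subT-⊙ σ τ u)

  liftS-⊙ : ∀ {k m n} (σ : Fin m → Term n) (τ : Fin k → Term m) i →
            (liftS σ ⊙ liftS τ) i ≡ liftS (σ ⊙ τ) i
  liftS-⊙ σ τ zero = refl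
  liftS-⊙ σ τ (suc i) with τ i
  ... | var j = refl
  ... | par a = refl

  sub-⊙ : ∀ {k m n} (σ : Fin m → Term n) (τ : Fin k → Term m) φ →
          sub σ (sub τ φ) ≡ sub (σ ⊙ τ) φ
  sub-⊙ σ τ (lit b A) = cong (lit b) (subA-⊙ σ τ A)
  sub-⊙ σ τ (φ ∧' ψ)  = cong₂ _∧'_ (sub-⊙ σ τ φ) (sub-⊙ σ τ ψ)
  sub-⊙ σ τ (φ ∨' ψ)  = cong₂ _∨'_ (sub-⊙ σ τ φ) (sub-⊙ σ τ ψ)
  sub-⊙ σ τ (all θ)   = cong all (trans (sub-⊙ (liftS σ) (liftS τ) θ) (sub-cong (liftS-⊙ σ τ) θ))
  sub-⊙ σ τ (ex θ)    = cong ex (trans (sub-⊙ (liftS σ) (liftS τ) θ) (sub-cong (liftS-⊙ σ τ) θ))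

  subT-var : ∀ {n} (t : Term n) → subT var t ≡ t
  subT-var (var i) = refl
  subT-var (par a) = refl

  subA-var : ∀ {n} (A : Atom n) → subA var A ≡ A
  subA-var (mem t u) = cong₂ mem (subT-var t) (subT-var u)
  subA-var (eqt t u) = cong₂ eqt (subT-var t) (subT-var u)

  liftS-var : ∀ {n} (i : Fin (suc n)) → liftS var i ≡ var i
  liftS-var zero    = refl
  liftS-var (suc i) = refl

  sub-var : ∀ {n} (φ : Formula n) → sub var φ ≡ φ
  sub-var (lit b A) = cong (lit b) (subA-var A)
  sub-var (φ ∧' ψ)  = cong₂ _∧'_ (sub-var φ) (sub-var ψ)
  sub-var (φ ∨' ψ)  = cong₂ _∨'_ (sub-var φ) (sub-var ψ)
  sub-var (all θ)   = cong all (trans (sub-cong liftS-var θ) (sub-var θ))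
  sub-var (ex θ)    = cong ex (trans (sub-cong liftS-var θ) (sub-var θ))

  inst-closed : (ρ : Fin 0 → V) (φ : Formula 0) → φ ≡ inst ρ φ
  inst-closed ρ φ = begin
    φ            ≡⟨ sub-var φ ⟨
    sub var φ    ≡⟨ sub-cong (λ ()) φ ⟩
    inst ρ φ     ∎
    where open ≡-Reasoning

  inst-[] : ∀ {n} (ρ : Fin n → V) (θ : Formula (suc n)) (a : V) →
            sub (liftS (λ i → par (ρ i))) θ [ a ] ≡ inst (a ∷ᵥ ρ) θ
  inst-[] ρ θ a = trans (sub-⊙ (single a) (liftS (λ i → par (ρ i))) θ)
                        (sub-cong single-after-lift θ)
    where
    single-after-lift : ∀ i → (single a ⊙ liftS (λ i → par (ρ i))) i ≡ par ((a ∷ᵥ ρ) i)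
    single-after-lift zero    = refl
    single-after-lift (suc i) = refl

  ≼-trans : ∀ {k m n} {φ : Formula k} {ψ : Formula m} {T : Formula n} →
            φ ≼ ψ → ψ ≼ T → φ ≼ T
  ≼-trans p here   = p
  ≼-trans p (∧ˡ q) = ∧ˡ (≼-trans p q)
  ≼-trans p (∧ʳ q) = ∧ʳ (≼-trans p q)
  ≼-trans p (∨ˡ q) = ∨ˡ (≼-trans p q)
  ≼-trans p (∨ʳ q) = ∨ʳ (≼-trans p q)
  ≼-trans p (∀ᵇ q) = ∀ᵇ (≼-trans p q)
  ≼-trans p (∃ᵇ q) = ∃ᵇ (≼-trans p q)

  module Instances (T₁ T₂ : Formula 0) where

    SubOfRoots : ∀ {n} → Formula n → Set
    SubOfRoots φ = (φ ≼ T₁) ⊎ (φ ≼ T₂)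

    Instance : Formula 0 → Set
    Instance χ = Σ ℕ λ n → Σ (Formula n) λ φ →
                   SubOfRoots φ × Σ (Fin n → V) λ ρ → χ ≡ inst ρ φ

    below : ∀ {m k} {φ : Formula m} {ψ : Formula k} → ψ ≼ φ →
            SubOfRoots φ → SubOfRoots ψ
    below p (inj₁ q) = inj₁ (≼-trans p q)
    below p (inj₂ q) = inj₂ (≼-trans p q)

    root₁ : Instance T₁
    root₁ = 0 , T₁ , inj₁ here , (λ ()) , inst-closed (λ ()) T₁

    root₂ : Instance T₂
    root₂ = 0 , T₂ , inj₂ here , (λ ()) , inst-closed (λ ()) T₂

    -- Closure of instances under the component operations of the tree rules.
    -- An instance of the given shape must come from a formula of that shape.
    conjunct₀ : ∀ {χ₀ χ₁} → Instance (χ₀ ∧' χ₁) → Instance χ₀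
    conjunct₀ (n , φ₀ ∧' φ₁ , s , ρ , refl) = n , φ₀ , below (∧ˡ here) s , ρ , refl

    conjunct₁ : ∀ {χ₀ χ₁} → Instance (χ₀ ∧' χ₁) → Instance χ₁
    conjunct₁ (n , φ₀ ∧' φ₁ , s , ρ , refl) = n , φ₁ , below (∧ʳ here) s , ρ , refl

    disjunct₀ : ∀ {χ₀ χ₁} → Instance (χ₀ ∨' χ₁) → Instance χ₀
    disjunct₀ (n , φ₀ ∨' φ₁ , s , ρ , refl) = n , φ₀ , below (∨ˡ here) s , ρ , refl

    disjunct₁ : ∀ {χ₀ χ₁} → Instance (χ₀ ∨' χ₁) → Instance χ₁
    disjunct₁ (n , φ₀ ∨' φ₁ , s , ρ , refl) = n , φ₁ , below (∨ʳ here) s , ρ , refl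

    all-instance : ∀ {θ} → Instance (all θ) → ∀ a → Instance (θ [ a ])
    all-instance (n , all θ , s , ρ , refl) a =
      suc n , θ , below (∀ᵇ here) s , a ∷ᵥ ρ , inst-[] ρ θ a

    ex-instance : ∀ {θ} → Instance (ex θ) → ∀ a → Instance (θ [ a ])
    ex-instance (n , ex θ , s , ρ , refl) a =
      suc n , θ , below (∃ᵇ here) s , a ∷ᵥ ρ , inst-[] ρ θ a

  module TreeInvariant (r : V) (ψ : Formula 1) where
    open Tree r ψ
    open Instances (negF (ψ [ r ])) (negF Ext)

    sequent-instances : ∀ {M σ Λ} → Node M σ Λ → All Instance Λ
    sequent-instances root = root₁ ∷ root₂ ∷ []
    sequent-instances (falseLit node _) with sequent-instances node
    ... | i ∷ is = ∷ʳ⁺ is i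
    sequent-instances (and0 node) with sequent-instances node
    ... | i ∷ is = ++⁺ is (i ∷ conjunct₀ i ∷ [])
    sequent-instances (and1 node) with sequent-instances node
    ... | i ∷ is = ++⁺ is (i ∷ conjunct₁ i ∷ [])
    sequent-instances (or0 node) with sequent-instances node
    ... | i ∷ is = ++⁺ is (i ∷ disjunct₀ i ∷ disjunct₁ i ∷ [])
    sequent-instances (allR a _ node) with sequent-instances node
    ... | i ∷ is = ++⁺ is (i ∷ all-instance i a ∷ [])
    sequent-instances (exR {σ = σ} k node _ _) with sequent-instances node
    ... | i ∷ is = ++⁺ is (i ∷ ex-instance i (cand σ k) ∷ [])

lemma3p4 : (V : Set) (_∈V_ : V → V → Set) (num : ℕ → V) →
    Injective _≡_ _≡_ num →
    let open SetTheory V _∈V_ num in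
    (ψ : Formula 1) → NoParams ψ →
    (r : V) → (∀ z → z ∈V r → ∃ λ n → z ≡ num n) →
    let open Tree r ψ in
    (σ : List V) (Λ : List (Formula 0)) → InSV σ Λ →
    ∀ χ → χ ∈ Λ →
    Σ ℕ λ n → Σ (Formula n) λ φ →
    ((φ ≼ negF (ψ [ r ])) ⊎ (φ ≼ negF Ext)) ×
    Σ (Fin n → V) λ ρ → χ ≡ inst ρ φ
lemma3p4 V _∈V_ num _ ψ _ r _ σ Λ node χ χ∈Λ =
  lookup (SubformulaProperty.TreeInvariant.sequent-instances V _∈V_ num r ψ node) χ∈Λ
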